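{- Let $m_1,m_2$ be positive integers, $\mathcal{K}=2\,\mathrm{lcm}(m_1,m_2)$, and $(x_1,x_2)\in\mathcal{S}^2$. Then for $i=1,2$, \[\sum_{k=1}^{\mathcal{K}}f_i^{k}(x_i)=m_i\,\mathrm{lcm}(m_1,m_2),\qquad\text{and}\qquad \sum_{k=1}^{\mathcal{K}}\sum_{i=1}^{2}f_i^{k}(x_i)=(m_1+m_2)\,\mathrm{lcm}(m_1,m_2).\]
   Context: $\mathcal{S}^2=\{(x_1,x_2)\in\mathbb{Z}^2: 0\le x_i\le m_i,\ i=1,2\}$. For a positive integer $m$ let $\varphi_m(u)=\min_{n\in\mathbb{Z}}|u-2nm|$ for $u\in\mathbb{Z}$ (the $2m$-periodic triangle wave with $\varphi_m(u)=u$ for $0\le u\le m$). For $k\in\mathbb{Z}$, $f_i^k(x)=\varphi_{m_i}(x+k)$; the points $(f_1^k(x_1),f_2^k(x_2))$, $k=1,\dots,\mathcal{K}$, are the points (with repetition) passed by the closed path of a light beam started at $(x_1,x_2)$ in direction $(+1,+1)$ with mirror boundary on $[0,m_1]\times[0,m_2]$. -}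

module Defs where

open import Data.Nat using (ℕ; zero; suc; _+_; _*_; _∸_; _⊓_)
open import Data.Integer using (ℤ; +_)
open import Data.Integer.DivMod using (_%ℕ_)

-- φ_m(u) = min_{n ∈ ℤ} |u - 2nm|, the 2m-periodic triangle wave.
-- Writing r = u mod 2m ∈ [0, 2m), the minimum is attained at the nearest
-- multiples of 2m, so φ_m(u) = min(r, 2m - r).  (For m = 0 we return 0;
-- this case never occurs, since m is assumed positive.)
φ : ℕ → ℤ → ℕ
φ zero    u = 0
φ (suc k) u = let r = u %ℕ (2 * suc k) in r ⊓ (2 * suc k ∸ r)

f : ℕ → ℤ → ℕ → ℕ
f m k x = φ m (+ x Data.Integer.+ k)

Σ[1…_] : ℕ → (ℕ → ℕ) → ℕ
Σ[1… zero  ] g = 0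
Σ[1… suc K ] g = Σ[1… K ] g + g (suc K)

-- Reduced modulo 2m, the triangle wave φ_m satisfies φ_m(u) + φ_m(u + m) = m:
-- on [0, m] it is the identity and on [m, 2m] it is u ↦ 2m − u.  Hence φ_m
-- summed over m consecutive pairs {u, u + m}, i.e. over one full period 2m,
-- gives m², and 2 lcm(m₁, m₂) = (lcm(m₁, m₂) / mᵢ) · 2mᵢ consists of whole
-- periods of φ_{mᵢ}.
module Submission where

open import Defs
open import Data.Nat using (ℕ; zero; suc; _+_; _*_; _∸_; _⊓_; _%_; _≤_; _<_; NonZero; >-nonZero⁻¹)
open import Data.Nat.DivMod using (%-congˡ; [m+n]%n≡m%n; %-distribˡ-+; m<n⇒m%n≡m; m%n<n)
open import Data.Nat.Divisibility using (_∣_; divides)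
open import Data.Nat.LCM using (lcm; m∣lcm[m,n]; n∣lcm[m,n])
open import Data.Nat.Properties
open import Data.Nat.Solver using (module +-*-Solver)
open import Data.Integer using (+_)
open import Data.Product using (_×_; _,_)
open import Relation.Binary.PropositionalEquality
  using (_≡_; refl; sym; trans; cong; cong₂; subst; subst₂; module ≡-Reasoning)
open import Relation.Nullary using (yes; no)

open import Algebra.Properties.CommutativeSemigroup +-commutativeSemigroup
  using (interchange; x∙yz≈y∙xz)
open ≡-Reasoning

tent : ℕ → ℕ → ℕ
tent d r = r ⊓ (d ∸ r)

module _ (m : ℕ) .{{_ : NonZero m}} where

  2m≡m+m : 2 * m ≡ m + m
  2m≡m+m = cong (λ s → m + s) (+-identityʳ m)

  m<2m : m < 2 * m
  m<2m = subst (m <_) (sym 2m≡m+m) (m<m+n m (>-nonZero⁻¹ m))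

  private instance
    2m≢0 : NonZero (2 * m)
    2m≢0 = m*n≢0 2 m

  tent-rising : ∀ {t} → t ≤ m → tent (2 * m) t ≡ t
  tent-rising {t} t≤m = m≤n⇒m⊓n≡m (≤-trans t≤m (m+n≤o⇒m≤o∸n m m+t≤2m))
    where
    m+t≤2m : m + t ≤ 2 * m
    m+t≤2m = +-monoʳ-≤ m (≤-trans t≤m (m≤m+n m 0))

  tent-falling : ∀ {t} → t ≤ m → tent (2 * m) (t + m) ≡ m ∸ t
  tent-falling {t} t≤m = begin
    (t + m) ⊓ (2 * m ∸ (t + m)) ≡⟨ cong ((t + m) ⊓_) 2m∸[t+m]≡m∸t ⟩
    (t + m) ⊓ (m ∸ t)           ≡⟨ m≥n⇒m⊓n≡n (≤-trans (m∸n≤m m t) (m≤n+m m t)) ⟩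
    m ∸ t                       ∎
    where
    2m∸[t+m]≡m∸t : 2 * m ∸ (t + m) ≡ m ∸ t
    2m∸[t+m]≡m∸t = begin
      m + (m + 0) ∸ (t + m) ≡⟨ cong (m + (m + 0) ∸_) (+-comm t m) ⟩
      m + (m + 0) ∸ (m + t) ≡⟨ [m+n]∸[m+o]≡n∸o m (m + 0) t ⟩
      m + 0 ∸ t             ≡⟨ cong (_∸ t) (+-identityʳ m) ⟩
      m ∸ t                 ∎

  tent-antiperiodic : ∀ r → r < 2 * m → tent (2 * m) r + tent (2 * m) ((r + m) % (2 * m)) ≡ m
  tent-antiperiodic r r<2m with r <? m
  ... | yes r<m = begin
    tent (2 * m) r + tent (2 * m) ((r + m) % (2 * m))
      ≡⟨ cong (λ s → tent (2 * m) r + tent (2 * m) s) [r+m]%2m≡r+m ⟩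
    tent (2 * m) r + tent (2 * m) (r + m)
      ≡⟨ cong₂ _+_ (tent-rising (<⇒≤ r<m)) (tent-falling (<⇒≤ r<m)) ⟩
    r + (m ∸ r)
      ≡⟨ m+[n∸m]≡n (<⇒≤ r<m) ⟩
    m ∎
    where
    [r+m]%2m≡r+m : (r + m) % (2 * m) ≡ r + m
    [r+m]%2m≡r+m = m<n⇒m%n≡m (subst (r + m <_) (sym 2m≡m+m) (+-monoˡ-< m r<m))
  ... | no r≮m = begin
    tent (2 * m) r + tent (2 * m) ((r + m) % (2 * m))
      ≡⟨ cong (λ s → tent (2 * m) s + tent (2 * m) ((s + m) % (2 * m))) r≡t+m ⟩
    tent (2 * m) (t + m) + tent (2 * m) ((t + m + m) % (2 * m))
      ≡⟨ cong (λ s → tent (2 * m) (t + m) + tent (2 * m) s) [t+m+m]%2m≡t ⟩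
    tent (2 * m) (t + m) + tent (2 * m) t
      ≡⟨ cong₂ _+_ (tent-falling (<⇒≤ t<m)) (tent-rising (<⇒≤ t<m)) ⟩
    (m ∸ t) + t
      ≡⟨ m∸n+n≡m (<⇒≤ t<m) ⟩
    m ∎
    where
    t : ℕ
    t = r ∸ m
    r≡t+m : r ≡ t + m
    r≡t+m = sym (m∸n+n≡m (≮⇒≥ r≮m))
    t<m : t < m
    t<m = +-cancelʳ-< m t m (subst₂ _<_ r≡t+m 2m≡m+m r<2m)
    [t+m+m]%2m≡t : (t + m + m) % (2 * m) ≡ t
    [t+m+m]%2m≡t = begin
      (t + m + m) % (2 * m)   ≡⟨ %-congˡ (trans (+-assoc t m m) (cong (λ s → t + s) (sym 2m≡m+m))) ⟩
      (t + 2 * m) % (2 * m)   ≡⟨ [m+n]%n≡m%n t (2 * m) ⟩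
      t % (2 * m)             ≡⟨ m<n⇒m%n≡m (<-trans t<m m<2m) ⟩
      t                       ∎

φ-antiperiodic : ∀ {m} → 0 < m → ∀ n → φ m (+ n) + φ m (+ (n + m)) ≡ m
φ-antiperiodic {m@(suc _)} _ n = begin
  -- φ m (+ n) unfolds to tent (2 * m) (n % (2 * m))
  tent (2 * m) (n % (2 * m)) + tent (2 * m) ((n + m) % (2 * m))
    ≡⟨ cong (λ s → tent (2 * m) (n % (2 * m)) + tent (2 * m) s) [n+m]%2m≡[n%2m+m]%2m ⟩
  tent (2 * m) (n % (2 * m)) + tent (2 * m) ((n % (2 * m) + m) % (2 * m))
    ≡⟨ tent-antiperiodic m (n % (2 * m)) (m%n<n n (2 * m)) ⟩
  m ∎
  where
  [n+m]%2m≡[n%2m+m]%2m : (n + m) % (2 * m) ≡ (n % (2 * m) + m) % (2 * m)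
  [n+m]%2m≡[n%2m+m]%2m = trans (%-distribˡ-+ n m (2 * m))
    (cong (λ s → (n % (2 * m) + s) % (2 * m)) (m<n⇒m%n≡m (m<2m m)))

Σ-cong : ∀ n {g h : ℕ → ℕ} → (∀ k → g k ≡ h k) → Σ[1… n ] g ≡ Σ[1… n ] h
Σ-cong zero    g≗h = refl
Σ-cong (suc n) g≗h = cong₂ _+_ (Σ-cong n g≗h) (g≗h (suc n))

Σ-distrib-+ : ∀ n (g h : ℕ → ℕ) → Σ[1… n ] (λ k → g k + h k) ≡ Σ[1… n ] g + Σ[1… n ] h
Σ-distrib-+ zero    g h = refl
Σ-distrib-+ (suc n) g h = trans (cong (_+ (g (suc n) + h (suc n))) (Σ-distrib-+ n g h))
  (interchange (Σ[1… n ] g) (Σ[1… n ] h) (g (suc n)) (h (suc n)))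

Σ-const : ∀ n c → Σ[1… n ] (λ _ → c) ≡ n * c
Σ-const zero    c = refl
Σ-const (suc n) c = trans (cong (_+ c) (Σ-const n c)) (+-comm (n * c) c)

Σ-split : ∀ a b (g : ℕ → ℕ) → Σ[1… a + b ] g ≡ Σ[1… a ] g + Σ[1… b ] (λ k → g (a + k))
Σ-split a zero    g = trans (cong (λ n → Σ[1… n ] g) (+-identityʳ a)) (sym (+-identityʳ _))
Σ-split a (suc b) g = begin
  Σ[1… a + suc b ] g
    ≡⟨ cong (λ n → Σ[1… n ] g) (+-suc a b) ⟩
  Σ[1… a + b ] g + g (suc (a + b))
    ≡⟨ cong₂ _+_ (Σ-split a b g) (cong g (sym (+-suc a b))) ⟩
  Σ[1… a ] g + Σ[1… b ] (λ k → g (a + k)) + g (a + suc b)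
    ≡⟨ +-assoc (Σ[1… a ] g) _ _ ⟩
  Σ[1… a ] g + (Σ[1… b ] (λ k → g (a + k)) + g (a + suc b)) ∎

Σ-antiperiodic-period : ∀ p c (g : ℕ → ℕ) → (∀ k → g k + g (p + k) ≡ c) →
                        Σ[1… p + p ] g ≡ p * c
Σ-antiperiodic-period p c g antiperiodic = begin
  Σ[1… p + p ] g                                     ≡⟨ Σ-split p p g ⟩
  Σ[1… p ] g + Σ[1… p ] (λ k → g (p + k))            ≡⟨ Σ-distrib-+ p g _ ⟨
  Σ[1… p ] (λ k → g k + g (p + k))                   ≡⟨ Σ-cong p antiperiodic ⟩
  Σ[1… p ] (λ _ → c)                                 ≡⟨ Σ-const p c ⟩
  p * c                                              ∎

Σ-antiperiodic-periods : ∀ p c q (g : ℕ → ℕ) → (∀ k → g k + g (p + k) ≡ c) →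
                         Σ[1… q * (p + p) ] g ≡ q * (p * c)
Σ-antiperiodic-periods p c zero    g antiperiodic = refl
Σ-antiperiodic-periods p c (suc q) g antiperiodic = begin
  Σ[1… p + p + q * (p + p) ] g
    ≡⟨ Σ-split (p + p) (q * (p + p)) g ⟩
  Σ[1… p + p ] g + Σ[1… q * (p + p) ] (λ k → g (p + p + k))
    ≡⟨ cong₂ _+_ (Σ-antiperiodic-period p c g antiperiodic)
                 (Σ-antiperiodic-periods p c q _ shifted) ⟩
  p * c + q * (p * c) ∎
  where
  shifted : ∀ k → g (p + p + k) + g (p + p + (p + k)) ≡ c
  shifted k = trans (cong (λ n → g (p + p + k) + g n) (x∙yz≈y∙xz (p + p) p k))
                    (antiperiodic (p + p + k))

Σ-f-whole-periods : ∀ {m L} x → 0 < m → m ∣ L → Σ[1… 2 * L ] (λ k → f m (+ k) x) ≡ m * L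
Σ-f-whole-periods {m} x 0<m (divides q refl) = begin
  Σ[1… 2 * (q * m) ] (λ k → φ m (+ (x + k)))
    ≡⟨ cong (λ n → Σ[1… n ] (λ k → φ m (+ (x + k))))
            (solve 2 (λ q m → con 2 :* (q :* m) := q :* (m :+ m)) refl q m) ⟩
  Σ[1… q * (m + m) ] (λ k → φ m (+ (x + k)))
    ≡⟨ Σ-antiperiodic-periods m m q _ antiperiodic ⟩
  q * (m * m)
    ≡⟨ solve 2 (λ q m → q :* (m :* m) := m :* (q :* m)) refl q m ⟩
  m * (q * m) ∎
  where
  open +-*-Solver
  antiperiodic : ∀ k → φ m (+ (x + k)) + φ m (+ (x + (m + k))) ≡ m
  antiperiodic k = trans (cong (λ n → φ m (+ (x + k)) + φ m (+ n)) x+[m+k]≡x+k+m)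
                         (φ-antiperiodic 0<m (x + k))
    where
    x+[m+k]≡x+k+m : x + (m + k) ≡ x + k + m
    x+[m+k]≡x+k+m = trans (cong (λ s → x + s) (+-comm m k)) (sym (+-assoc x k m))

corollary3p13 : (m₁ m₂ : ℕ) → 0 < m₁ → 0 < m₂ →
    (x₁ x₂ : ℕ) → x₁ ≤ m₁ → x₂ ≤ m₂ →
    (Σ[1… 2 * lcm m₁ m₂ ] (λ k → f m₁ (+ k) x₁) ≡ m₁ * lcm m₁ m₂)
    × (Σ[1… 2 * lcm m₁ m₂ ] (λ k → f m₂ (+ k) x₂) ≡ m₂ * lcm m₁ m₂)
    × (Σ[1… 2 * lcm m₁ m₂ ] (λ k → f m₁ (+ k) x₁ + f m₂ (+ k) x₂)
    ≡ (m₁ + m₂) * lcm m₁ m₂)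
corollary3p13 m₁ m₂ 0<m₁ 0<m₂ x₁ x₂ _ _ = sum₁ , sum₂ , (begin
  Σ[1… 2 * L ] (λ k → f m₁ (+ k) x₁ + f m₂ (+ k) x₂)
    ≡⟨ Σ-distrib-+ (2 * L) _ _ ⟩
  Σ[1… 2 * L ] (λ k → f m₁ (+ k) x₁) + Σ[1… 2 * L ] (λ k → f m₂ (+ k) x₂)
    ≡⟨ cong₂ _+_ sum₁ sum₂ ⟩
  m₁ * L + m₂ * L
    ≡⟨ *-distribʳ-+ L m₁ m₂ ⟨
  (m₁ + m₂) * L ∎)
  where
  L : ℕ
  L = lcm m₁ m₂
  sum₁ : Σ[1… 2 * L ] (λ k → f m₁ (+ k) x₁) ≡ m₁ * L
  sum₁ = Σ-f-whole-periods x₁ 0<m₁ (m∣lcm[m,n] m₁ m₂)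
  sum₂ : Σ[1… 2 * L ] (λ k → f m₂ (+ k) x₂) ≡ m₂ * L
  sum₂ = Σ-f-whole-periods x₂ 0<m₂ (n∣lcm[m,n] m₁ m₂)
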